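{- Let $N$ and $\Delta$ be integers with $\frac N2<\Delta\le N$. Then for every integer $M$ with $\binom{\Delta}{2}\leq M\leq f(N,\Delta)$ there is a graph $G$ with $e(G)=N$ and $e(L(G))=M$.
   Context: All graphs are finite and simple; $L(G)$ is the line graph, so $e(L(G))=\sum_v\binom{\deg(v)}{2}$. For integers $N\ge\Delta\ge1$, $f(N,\Delta)=\max\{e(L(G)) : e(G)=N,\ \Delta(G)=\Delta,\ \delta(G)\geq1\}$. -}

module Defs where

open import Data.Nat using (ℕ; zero; suc; _+_; _⊔_; _≤_; _<_)
open import Data.Nat.Combinatorics using (_C_)
open import Data.Bool using (Bool; true; false; if_then_else_; _∧_)
open import Data.Fin using (Fin; zero; suc; toℕ)
open import Data.Fin using () renaming (_<?_ to _<ᶠ?_)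
open import Relation.Nullary.Decidable using (⌊_⌋)
open import Relation.Binary.PropositionalEquality using (_≡_)

record Graph (n : ℕ) : Set where
  field
    adj : Fin n → Fin n → Bool
    adj-sym : ∀ i j → adj i j ≡ adj j i
    adj-irr : ∀ i → adj i i ≡ false
open Graph public

sumF : ∀ {n} → (Fin n → ℕ) → ℕ
sumF {zero} f = 0
sumF {suc n} f = f zero + sumF (λ i → f (suc i))

maxF : ∀ {n} → (Fin n → ℕ) → ℕ
maxF {zero} f = 0
maxF {suc n} f = f zero ⊔ maxF (λ i → f (suc i))

countF : ∀ {n} → (Fin n → Bool) → ℕ
countF p = sumF (λ i → if p i then 1 else 0)

degree : ∀ {n} → Graph n → Fin n → ℕ
degree G v = countF (adj G v)

edges : ∀ {n} → Graph n → ℕ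
edges G = sumF (λ i → countF (λ j → ⌊ i <ᶠ? j ⌋ ∧ adj G i j))

-- e(L(G)) = Σ_v C(deg v, 2).
lineEdges : ∀ {n} → Graph n → ℕ
lineEdges G = sumF (λ v → degree G v C 2)

maxDegree : ∀ {n} → Graph n → ℕ
maxDegree G = maxF (degree G)

MinDegreeAtLeast1 : ∀ {n} → Graph n → Set
MinDegreeAtLeast1 G = ∀ v → 1 ≤ degree G v

Admissible : ℕ → ℕ → ∀ {n} → Graph n → Set
Admissible N Δ G = (edges G ≡ N) Data.Product.× ((maxDegree G ≡ Δ) Data.Product.× MinDegreeAtLeast1 G)
  where import Data.Product

-- M ≤ f(N,Δ), where f(N,Δ) = max{ e(L(G)) : G admissible }.  Since the set
-- of admissible graphs (up to isomorphism) is finite, M ≤ max S  iff  some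
-- element of S is ≥ M.
LeF : ℕ → ℕ → ℕ → Set
LeF M N Δ = Data.Product.Σ ℕ (λ n → Data.Product.Σ (Graph n) (λ H →
              Admissible N Δ H Data.Product.× (M ≤ lineEdges H)))
  where import Data.Product

{-# OPTIONS --safe #-}
module Submission where

-- Let v be a vertex of maximum degree Δ in a graph with N edges, and k = N − Δ the number of
-- edges missing v; N < 2Δ gives k < Δ.  Deleting v lowers every other degree by at most one, so
-- e(L(G)) ≤ C(Δ,2) + C(k,2) + 2k = C(Δ,2) + C(k+1,2) + k.  Conversely every t up to that bound
-- is C(c+1,2) + j with j ≤ c ≤ k, and C(Δ,2) + t is attained by two adjacent centres of
-- degrees Δ and c + 1 sharing j leaves, padded with k − c disjoint edges.

open import Defs
open import Data.Nat.Properties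
open import Algebra.Properties.CommutativeSemigroup +-commutativeSemigroup
  using (interchange; x∙yz≈y∙xz)
open import Data.Bool using (Bool; true; false; not; if_then_else_; _∧_)
open import Data.Fin using (Fin; zero; suc; toℕ; punchIn)
open import Data.Fin using () renaming (_<?_ to _<ᶠ?_)
open import Data.Nat using (ℕ; zero; suc; _+_; _*_; _∸_; _≤_; _<_; _<ᵇ_; z≤n; s≤s; s≤s⁻¹)
open import Data.Nat.Combinatorics using (_C_; nCk+nC[k+1]≡[n+1]C[k+1]; nC1≡n)
open import Data.Nat.Tactic.RingSolver using (solve-∀)
open import Data.Product using (Σ; _×_; _,_; proj₁; proj₂)
open import Data.Sum using (inj₁; inj₂)
open import Function using (_∘_)
open import Relation.Binary.PropositionalEquality
open import Relation.Nullary using (yes; no)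
open import Relation.Nullary.Decidable using (⌊_⌋; ⌊⌋-map′)

-- countF p unfolds to sumF (boolToℕ ∘ p).
boolToℕ : Bool → ℕ
boolToℕ b = if b then 1 else 0

boolToℕ-*-≤ : ∀ b n → boolToℕ b * n ≤ n
boolToℕ-*-≤ true  n = ≤-reflexive (*-identityˡ n)
boolToℕ-*-≤ false n = z≤n

[1+n]C2≡n+nC2 : ∀ n → suc n C 2 ≡ n + n C 2
[1+n]C2≡n+nC2 n = trans (sym (nCk+nC[k+1]≡[n+1]C[k+1] n 1)) (cong (_+ n C 2) (nC1≡n n))

[m+n]C2≡mC2+nC2+m*n : ∀ m n → (m + n) C 2 ≡ m C 2 + n C 2 + m * n
[m+n]C2≡mC2+nC2+m*n zero    n = sym (+-identityʳ (n C 2))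
[m+n]C2≡mC2+nC2+m*n (suc m) n = begin
  suc (m + n) C 2                  ≡⟨ [1+n]C2≡n+nC2 (m + n) ⟩
  m + n + (m + n) C 2              ≡⟨ cong (m + n +_) ([m+n]C2≡mC2+nC2+m*n m n) ⟩
  m + n + (m C 2 + n C 2 + m * n)  ≡⟨ regroup m n (m C 2) (n C 2) ⟩
  m + m C 2 + n C 2 + (n + m * n)  ≡⟨ cong (λ x → x + n C 2 + (n + m * n)) (sym ([1+n]C2≡n+nC2 m)) ⟩
  suc m C 2 + n C 2 + suc m * n    ∎
  where
  open ≡-Reasoning
  regroup : ∀ m n x y → m + n + (x + y + m * n) ≡ m + x + y + (n + m * n)
  regroup = solve-∀

[b+n]C2≡nC2+b*n : ∀ b n → (boolToℕ b + n) C 2 ≡ n C 2 + boolToℕ b * n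
[b+n]C2≡nC2+b*n true  n = [m+n]C2≡mC2+nC2+m*n 1 n
[b+n]C2≡nC2+b*n false n = [m+n]C2≡mC2+nC2+m*n 0 n

nC2+2n≡[1+n]C2+n : ∀ n → n C 2 + 2 * n ≡ suc n C 2 + n
nC2+2n≡[1+n]C2+n n = trans (regroup n (n C 2)) (cong (_+ n) (sym ([1+n]C2≡n+nC2 n)))
  where
  regroup : ∀ n x → x + 2 * n ≡ n + x + n
  regroup = solve-∀

sumF-cong : ∀ {n} {f g : Fin n → ℕ} → (∀ i → f i ≡ g i) → sumF f ≡ sumF g
sumF-cong {zero}  f≗g = refl
sumF-cong {suc n} f≗g = cong₂ _+_ (f≗g zero) (sumF-cong (f≗g ∘ suc))

sumF-mono-≤ : ∀ {n} {f g : Fin n → ℕ} → (∀ i → f i ≤ g i) → sumF f ≤ sumF g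
sumF-mono-≤ {zero}  f≤g = z≤n
sumF-mono-≤ {suc n} f≤g = +-mono-≤ (f≤g zero) (sumF-mono-≤ (f≤g ∘ suc))

sumF-distrib-+ : ∀ {n} (f g : Fin n → ℕ) → sumF (λ i → f i + g i) ≡ sumF f + sumF g
sumF-distrib-+ {zero}  f g = refl
sumF-distrib-+ {suc n} f g =
  trans (cong (f zero + g zero +_) (sumF-distrib-+ (f ∘ suc) (g ∘ suc)))
        (interchange (f zero) (g zero) (sumF (f ∘ suc)) (sumF (g ∘ suc)))

sumF-*-distribʳ : ∀ {n} (f : Fin n → ℕ) c → sumF (λ i → f i * c) ≡ sumF f * c
sumF-*-distribʳ {zero}  f c = refl
sumF-*-distribʳ {suc n} f c =
  trans (cong (f zero * c +_) (sumF-*-distribʳ (f ∘ suc) c))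
        (sym (*-distribʳ-+ c (f zero) (sumF (f ∘ suc))))

sumF-const : ∀ n c → sumF {n} (λ _ → c) ≡ n * c
sumF-const zero    c = refl
sumF-const (suc n) c = cong (c +_) (sumF-const n c)

sumF-zero : ∀ n → sumF {n} (λ _ → 0) ≡ 0
sumF-zero n = trans (sumF-const n 0) (*-zeroʳ n)

sumF-punchIn : ∀ {n} v (f : Fin (suc n) → ℕ) → sumF f ≡ f v + sumF (f ∘ punchIn v)
sumF-punchIn zero f = refl
sumF-punchIn {zero}  (suc ()) f
sumF-punchIn {suc n} (suc v) f =
  trans (cong (f zero +_) (sumF-punchIn v (f ∘ suc)))
        (x∙yz≈y∙xz (f zero) (f (suc v)) (sumF (f ∘ suc ∘ punchIn v)))

-- Stated with _<ᵇ_ so that below (suc c) (suc i) reduces to below c i.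
below : ∀ {n} → ℕ → Fin n → Bool
below c i = toℕ i <ᵇ c

countF-below : ∀ {n} c → c ≤ n → countF (below {n} c) ≡ c
countF-below {n}     zero    z≤n       = sumF-zero n
countF-below {suc n} (suc c) (s≤s c≤n) = cong suc (countF-below c c≤n)

countF-not-below : ∀ b m → countF (not ∘ below {b + m} b) ≡ m
countF-not-below zero    m = trans (sumF-const m 1) (*-identityʳ m)
countF-not-below (suc b) m = countF-not-below b m

sumF-below-not-below : ∀ b {m} j → j ≤ m →
  sumF {b + m} (λ i → boolToℕ (below (b + j) i) * boolToℕ (not (below b i))) ≡ j
sumF-below-not-below zero {m} j j≤m =
  trans (sumF-cong {m} (λ i → *-identityʳ (boolToℕ (below j i)))) (countF-below j j≤m)
sumF-below-not-below (suc b) j j≤m = sumF-below-not-below b j j≤m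

maxF-attained : ∀ {n} (f : Fin (suc n) → ℕ) → Σ (Fin (suc n)) (λ v → f v ≡ maxF f)
maxF-attained {zero}  f = zero , sym (⊔-identityʳ (f zero))
maxF-attained {suc n} f with maxF-attained (f ∘ suc) | ≤-total (f zero) (maxF (f ∘ suc))
... | w , fw≡max | inj₁ f0≤max = suc w , trans fw≡max (sym (m≤n⇒m⊔n≡n f0≤max))
... | _          | inj₂ max≤f0 = zero , sym (m≥n⇒m⊔n≡m max≤f0)

⌊suc<ᶠ?suc⌋ : ∀ {n} (i j : Fin n) → ⌊ suc i <ᶠ? suc j ⌋ ≡ ⌊ i <ᶠ? j ⌋
⌊suc<ᶠ?suc⌋ i j = trans (⌊⌋-map′ _ _ _) (sym (⌊⌋-map′ _ _ _))

removeVertex : ∀ {n} → Graph (suc n) → Fin (suc n) → Graph n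
removeVertex G v = record
  { adj     = λ i j → adj G (punchIn v i) (punchIn v j)
  ; adj-sym = λ i j → adj-sym G (punchIn v i) (punchIn v j)
  ; adj-irr = λ i → adj-irr G (punchIn v i)
  }

degree≡countF-punchIn : ∀ {n} (G : Graph (suc n)) v →
  degree G v ≡ countF (λ i → adj G v (punchIn v i))
degree≡countF-punchIn G v =
  trans (sumF-punchIn v (boolToℕ ∘ adj G v))
        (cong (λ b → boolToℕ b + countF (λ i → adj G v (punchIn v i))) (adj-irr G v))

degree-punchIn : ∀ {n} (G : Graph (suc n)) v i →
  degree G (punchIn v i) ≡ boolToℕ (adj G v (punchIn v i)) + degree (removeVertex G v) i
degree-punchIn G v i =
  trans (sumF-punchIn v (boolToℕ ∘ adj G (punchIn v i)))
        (cong (λ b → boolToℕ b + degree (removeVertex G v) i) (adj-sym G (punchIn v i) v))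

edges-removeVertex₀ : ∀ {n} (G : Graph (suc n)) →
  edges G ≡ degree G zero + edges (removeVertex G zero)
edges-removeVertex₀ G = cong₂ _+_ (sym (degree≡countF-punchIn G zero)) (sumF-cong row)
  where
  row : ∀ i → countF (λ j → ⌊ suc i <ᶠ? j ⌋ ∧ adj G (suc i) j)
            ≡ countF (λ j → ⌊ i <ᶠ? j ⌋ ∧ adj G (suc i) (suc j))
  row i = sumF-cong (λ j → cong (λ b → boolToℕ (b ∧ adj G (suc i) (suc j))) (⌊suc<ᶠ?suc⌋ i j))

sumF-degree-removeVertex : ∀ {n} (G : Graph (suc n)) v →
  sumF (degree G) ≡ 2 * degree G v + sumF (degree (removeVertex G v))
sumF-degree-removeVertex G v = begin
  sumF (degree G)
    ≡⟨ sumF-punchIn v (degree G) ⟩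
  d + sumF (degree G ∘ punchIn v)
    ≡⟨ cong (d +_) (sumF-cong (degree-punchIn G v)) ⟩
  d + sumF (λ i → boolToℕ (adj G v (punchIn v i)) + degree G′ i)
    ≡⟨ cong (d +_) (sumF-distrib-+ (boolToℕ ∘ adj G v ∘ punchIn v) (degree G′)) ⟩
  d + (countF (adj G v ∘ punchIn v) + sumF (degree G′))
    ≡⟨ cong (λ x → d + (x + sumF (degree G′))) (sym (degree≡countF-punchIn G v)) ⟩
  d + (d + sumF (degree G′))
    ≡⟨ regroup d (sumF (degree G′)) ⟩
  2 * d + sumF (degree G′) ∎
  where
  open ≡-Reasoning
  d = degree G v
  G′ = removeVertex G v
  regroup : ∀ d s → d + (d + s) ≡ 2 * d + s
  regroup = solve-∀

handshake : ∀ {n} (G : Graph n) → sumF (degree G) ≡ 2 * edges G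
handshake {zero}  G = refl
handshake {suc n} G = begin
  sumF (degree G)                 ≡⟨ sumF-degree-removeVertex G zero ⟩
  2 * d + sumF (degree G′)        ≡⟨ cong (2 * d +_) (handshake G′) ⟩
  2 * d + 2 * edges G′            ≡⟨ sym (*-distribˡ-+ 2 d (edges G′)) ⟩
  2 * (d + edges G′)              ≡⟨ cong (2 *_) (sym (edges-removeVertex₀ G)) ⟩
  2 * edges G                     ∎
  where
  open ≡-Reasoning
  d = degree G zero
  G′ = removeVertex G zero

edges-removeVertex : ∀ {n} (G : Graph (suc n)) v →
  edges G ≡ degree G v + edges (removeVertex G v)
edges-removeVertex G v = *-cancelˡ-≡ _ _ 2 (begin
  2 * edges G                     ≡⟨ sym (handshake G) ⟩
  sumF (degree G)                 ≡⟨ sumF-degree-removeVertex G v ⟩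
  2 * d + sumF (degree G′)        ≡⟨ cong (2 * d +_) (handshake G′) ⟩
  2 * d + 2 * edges G′            ≡⟨ sym (*-distribˡ-+ 2 d (edges G′)) ⟩
  2 * (d + edges G′)              ∎)
  where
  open ≡-Reasoning
  d = degree G v
  G′ = removeVertex G v

lineEdges-removeVertex : ∀ {n} (G : Graph (suc n)) v →
  lineEdges G ≡ degree G v C 2 + (lineEdges (removeVertex G v)
    + sumF (λ i → boolToℕ (adj G v (punchIn v i)) * degree (removeVertex G v) i))
lineEdges-removeVertex G v = begin
  lineEdges G
    ≡⟨ sumF-punchIn v (λ u → degree G u C 2) ⟩
  d C 2 + sumF (λ i → degree G (punchIn v i) C 2)
    ≡⟨ cong (d C 2 +_) (sumF-cong (λ i →
         trans (cong (_C 2) (degree-punchIn G v i)) ([b+n]C2≡nC2+b*n (a i) (degree G′ i)))) ⟩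
  d C 2 + sumF (λ i → degree G′ i C 2 + boolToℕ (a i) * degree G′ i)
    ≡⟨ cong (d C 2 +_)
         (sumF-distrib-+ (λ i → degree G′ i C 2) (λ i → boolToℕ (a i) * degree G′ i)) ⟩
  d C 2 + (lineEdges G′ + sumF (λ i → boolToℕ (a i) * degree G′ i)) ∎
  where
  open ≡-Reasoning
  d = degree G v
  G′ = removeVertex G v
  a = adj G v ∘ punchIn v

degree≤edges : ∀ {n} (G : Graph n) v → degree G v ≤ edges G
degree≤edges {suc n} G v = ≤-trans (m≤m+n _ _) (≤-reflexive (sym (edges-removeVertex G v)))

lineEdges≤edgesC2 : ∀ {n} (G : Graph n) → lineEdges G ≤ edges G C 2
lineEdges≤edgesC2 {zero}  G = z≤n
lineEdges≤edgesC2 {suc n} G = begin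
  lineEdges G
    ≡⟨ lineEdges-removeVertex G zero ⟩
  d C 2 + (lineEdges G′ + sumF (λ i → a i * degree G′ i))
    ≤⟨ +-monoʳ-≤ (d C 2) (+-mono-≤ (lineEdges≤edgesC2 G′)
         (sumF-mono-≤ (λ i → *-monoʳ-≤ (a i) (degree≤edges G′ i)))) ⟩
  d C 2 + (e C 2 + sumF (λ i → a i * e))
    ≡⟨ cong (λ x → d C 2 + (e C 2 + x))
         (trans (sumF-*-distribʳ a e) (cong (_* e) (sym (degree≡countF-punchIn G zero)))) ⟩
  d C 2 + (e C 2 + d * e)
    ≡⟨ sym (trans ([m+n]C2≡mC2+nC2+m*n d e) (+-assoc (d C 2) (e C 2) (d * e))) ⟩
  (d + e) C 2
    ≡⟨ cong (_C 2) (sym (edges-removeVertex₀ G)) ⟩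
  edges G C 2 ∎
  where
  open ≤-Reasoning
  d = degree G zero
  G′ = removeVertex G zero
  e = edges G′
  a = boolToℕ ∘ adj G zero ∘ suc

lineEdges≤degreeC2+[1+e]C2+e : ∀ {n} (G : Graph (suc n)) v →
  let e = edges (removeVertex G v) in lineEdges G ≤ degree G v C 2 + (suc e C 2 + e)
lineEdges≤degreeC2+[1+e]C2+e G v = begin
  lineEdges G
    ≡⟨ lineEdges-removeVertex G v ⟩
  d C 2 + (lineEdges G′ + sumF (λ i → boolToℕ (adj G v (punchIn v i)) * degree G′ i))
    ≤⟨ +-monoʳ-≤ (d C 2) (+-mono-≤ (lineEdges≤edgesC2 G′)
         (sumF-mono-≤ (λ i → boolToℕ-*-≤ (adj G v (punchIn v i)) (degree G′ i)))) ⟩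
  d C 2 + (e C 2 + sumF (degree G′))
    ≡⟨ cong (λ x → d C 2 + (e C 2 + x)) (handshake G′) ⟩
  d C 2 + (e C 2 + 2 * e)
    ≡⟨ cong (d C 2 +_) (nC2+2n≡[1+n]C2+n e) ⟩
  d C 2 + (suc e C 2 + e) ∎
  where
  open ≤-Reasoning
  d = degree G v
  G′ = removeVertex G v
  e = edges G′

emptyGraph : ∀ n → Graph n
emptyGraph n = record { adj = λ _ _ → false ; adj-sym = λ _ _ → refl ; adj-irr = λ _ → refl }

degree-emptyGraph : ∀ n v → degree (emptyGraph n) v ≡ 0
degree-emptyGraph n v = sumF-zero n

edges-emptyGraph : ∀ n → edges (emptyGraph n) ≡ 0
edges-emptyGraph zero    = refl
edges-emptyGraph (suc n) =
  trans (edges-removeVertex₀ (emptyGraph (suc n))) (cong₂ _+_ (sumF-zero n) (edges-emptyGraph n))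

lineEdges-emptyGraph : ∀ n → lineEdges (emptyGraph n) ≡ 0
lineEdges-emptyGraph n = trans (sumF-cong (cong (_C 2) ∘ degree-emptyGraph n)) (sumF-zero n)

cone : ∀ {n} → Graph n → (Fin n → Bool) → Graph (suc n)
cone {n} G S = record { adj = A ; adj-sym = A-sym ; adj-irr = A-irr }
  where
  A : Fin (suc n) → Fin (suc n) → Bool
  A zero    zero    = false
  A zero    (suc j) = S j
  A (suc i) zero    = S i
  A (suc i) (suc j) = adj G i j
  A-sym : ∀ i j → A i j ≡ A j i
  A-sym zero    zero    = refl
  A-sym zero    (suc j) = refl
  A-sym (suc i) zero    = refl
  A-sym (suc i) (suc j) = adj-sym G i j
  A-irr : ∀ i → A i i ≡ false
  A-irr zero    = refl
  A-irr (suc i) = adj-irr G i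

edges-cone : ∀ {n} (G : Graph n) S → edges (cone G S) ≡ countF S + edges G
edges-cone G S = edges-removeVertex₀ (cone G S)

lineEdges-cone : ∀ {n} (G : Graph n) S →
  lineEdges (cone G S) ≡ countF S C 2 + (lineEdges G + sumF (λ i → boolToℕ (S i) * degree G i))
lineEdges-cone G S = lineEdges-removeVertex (cone G S) zero

star : ∀ {n} → (Fin n → Bool) → Graph (suc n)
star {n} = cone (emptyGraph n)

degree-star : ∀ {n} (S : Fin n → Bool) i → degree (star S) (suc i) ≡ boolToℕ (S i)
degree-star {n} S i = trans (cong (boolToℕ (S i) +_) (degree-emptyGraph n i)) (+-identityʳ _)

edges-star : ∀ {n} (S : Fin n → Bool) → edges (star S) ≡ countF S
edges-star {n} S =
  trans (edges-cone (emptyGraph n) S) (trans (cong (countF S +_) (edges-emptyGraph n)) (+-identityʳ _))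

lineEdges-star : ∀ {n} (S : Fin n → Bool) → lineEdges (star S) ≡ countF S C 2
lineEdges-star {n} S = begin
  lineEdges (star S)
    ≡⟨ lineEdges-cone (emptyGraph n) S ⟩
  countF S C 2 + (lineEdges (emptyGraph n) + sumF (λ i → boolToℕ (S i) * degree (emptyGraph n) i))
    ≡⟨ cong (countF S C 2 +_)
         (cong₂ _+_ (lineEdges-emptyGraph n) (trans (sumF-cong leafTerm) (sumF-zero n))) ⟩
  countF S C 2 + 0
    ≡⟨ +-identityʳ (countF S C 2) ⟩
  countF S C 2 ∎
  where
  open ≡-Reasoning
  leafTerm : ∀ i → boolToℕ (S i) * degree (emptyGraph n) i ≡ 0
  leafTerm i = trans (cong (boolToℕ (S i) *_) (degree-emptyGraph n i)) (*-zeroʳ (boolToℕ (S i)))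

addDisjointEdge : ∀ {n} → Graph n → Graph (2 + n)
addDisjointEdge G = cone (cone G (λ _ → false)) (below 1)

edges-addDisjointEdge : ∀ {n} (G : Graph n) → edges (addDisjointEdge G) ≡ suc (edges G)
edges-addDisjointEdge {n} G = begin
  edges (addDisjointEdge G)
    ≡⟨ edges-cone (cone G (λ _ → false)) (below 1) ⟩
  countF (below {suc n} 1) + edges (cone G (λ _ → false))
    ≡⟨ cong₂ _+_ (countF-below {suc n} 1 (s≤s z≤n)) (edges-cone G (λ _ → false)) ⟩
  1 + (countF {n} (λ _ → false) + edges G)
    ≡⟨ cong (λ x → 1 + (x + edges G)) (sumF-zero n) ⟩
  suc (edges G) ∎
  where open ≡-Reasoning

lineEdges-addDisjointEdge : ∀ {n} (G : Graph n) → lineEdges (addDisjointEdge G) ≡ lineEdges G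
lineEdges-addDisjointEdge {n} G = begin
  lineEdges (addDisjointEdge G)
    ≡⟨ lineEdges-cone H (below 1) ⟩
  countF (below {suc n} 1) C 2 + (lineEdges H + sumF (λ i → boolToℕ (below 1 i) * degree H i))
    ≡⟨ cong₂ (λ x y → x C 2 + (lineEdges H + y)) (countF-below {suc n} 1 (s≤s z≤n)) isolated ⟩
  lineEdges H + 0
    ≡⟨ +-identityʳ (lineEdges H) ⟩
  lineEdges H
    ≡⟨ lineEdges-cone G (λ _ → false) ⟩
  countF {n} (λ _ → false) C 2 + (lineEdges G + sumF {n} (λ _ → 0))
    ≡⟨ cong₂ (λ x y → x C 2 + (lineEdges G + y)) (sumF-zero n) (sumF-zero n) ⟩
  lineEdges G + 0
    ≡⟨ +-identityʳ (lineEdges G) ⟩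
  lineEdges G ∎
  where
  open ≡-Reasoning
  H = cone G (λ _ → false)
  isolated : sumF (λ i → boolToℕ (below 1 i) * degree H i) ≡ 0
  isolated = cong₂ _+_ (trans (+-identityʳ _) (sumF-zero n)) (sumF-zero n)

-- Vertex 0 is joined to vertex 1 and to the base vertices below b + j; vertex 1 is joined to
-- the base vertices from b on.  The j base vertices in [b, b + j) are the shared leaves.
module _ (b j m : ℕ) where

  private
    leaves₁ : Fin (b + m) → Bool
    leaves₁ = not ∘ below b

    leaves₀ : Fin (suc (b + m)) → Bool
    leaves₀ = below (suc (b + j))

    countF-leaves₀ : j ≤ m → countF leaves₀ ≡ suc (b + j)
    countF-leaves₀ j≤m = countF-below (suc (b + j)) (s≤s (+-monoʳ-≤ b j≤m))

  linkedStars : Graph (2 + (b + m))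
  linkedStars = cone (star leaves₁) leaves₀

  edges-linkedStars : j ≤ m → edges linkedStars ≡ suc (b + j) + m
  edges-linkedStars j≤m = begin
    edges linkedStars                    ≡⟨ edges-cone (star leaves₁) leaves₀ ⟩
    countF leaves₀ + edges (star leaves₁) ≡⟨ cong₂ _+_ (countF-leaves₀ j≤m) (edges-star leaves₁) ⟩
    suc (b + j) + countF leaves₁          ≡⟨ cong (suc (b + j) +_) (countF-not-below b m) ⟩
    suc (b + j) + m                       ∎
    where open ≡-Reasoning

  lineEdges-linkedStars : j ≤ m → lineEdges linkedStars ≡ suc (b + j) C 2 + (suc m C 2 + j)
  lineEdges-linkedStars j≤m = begin
    lineEdges linkedStars
      ≡⟨ lineEdges-cone (star leaves₁) leaves₀ ⟩
    countF leaves₀ C 2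
      + (lineEdges (star leaves₁) + sumF (λ i → boolToℕ (leaves₀ i) * degree (star leaves₁) i))
      ≡⟨ cong₂ (λ x y → x C 2 + y) (countF-leaves₀ j≤m) (cong₂ _+_ lineEdges-star₁ weighted) ⟩
    suc (b + j) C 2 + (m C 2 + (m + j))
      ≡⟨ cong (suc (b + j) C 2 +_) mC2+[m+j]≡[1+m]C2+j ⟩
    suc (b + j) C 2 + (suc m C 2 + j) ∎
    where
    open ≡-Reasoning
    lineEdges-star₁ : lineEdges (star leaves₁) ≡ m C 2
    lineEdges-star₁ = trans (lineEdges-star leaves₁) (cong (_C 2) (countF-not-below b m))
    weighted : sumF (λ i → boolToℕ (leaves₀ i) * degree (star leaves₁) i) ≡ m + j
    weighted = cong₂ _+_ (trans (+-identityʳ _) (countF-not-below b m))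
      (trans (sumF-cong (λ i → cong (boolToℕ (below (b + j) i) *_) (degree-star leaves₁ i)))
             (sumF-below-not-below b j j≤m))
    mC2+[m+j]≡[1+m]C2+j : m C 2 + (m + j) ≡ suc m C 2 + j
    mC2+[m+j]≡[1+m]C2+j = trans (sym (+-assoc (m C 2) m j))
      (cong (_+ j) (trans (+-comm (m C 2) m) (sym ([1+n]C2≡n+nC2 m))))

Realisable : ℕ → ℕ → Set
Realisable N M = Σ ℕ (λ n → Σ (Graph n) (λ G → (edges G ≡ N) × (lineEdges G ≡ M)))

realisable-+ : ∀ r {N M} → Realisable N M → Realisable (r + N) M
realisable-+ zero    R = R
realisable-+ (suc r) R with realisable-+ r R
... | n , G , eG≡N , LG≡M =
  2 + n , addDisjointEdge G ,
  trans (edges-addDisjointEdge G) (cong suc eG≡N) , trans (lineEdges-addDisjointEdge G) LG≡M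

C2-decomposition : ∀ k t → t ≤ suc k C 2 + k →
  Σ ℕ (λ b → Σ ℕ (λ j → (b + j ≤ k) × (t ≡ suc (b + j) C 2 + j)))
C2-decomposition zero    zero z≤n = 0 , 0 , z≤n , refl
C2-decomposition (suc k) t t≤ with t ≤? suc k C 2 + k
... | yes t≤′ with C2-decomposition k t t≤′
...   | b , j , b+j≤k , t≡ = b , j , m≤n⇒m≤1+n b+j≤k , t≡
C2-decomposition (suc k) t t≤ | no t≰ = suc k ∸ j , j , ≤-reflexive j′+j≡1+k , t≡
  where
  open ≤-Reasoning
  s = suc (suc k) C 2
  s≤t : s ≤ t
  s≤t = begin
    s                       ≡⟨ [1+n]C2≡n+nC2 (suc k) ⟩
    suc k + suc k C 2       ≡⟨ +-comm (suc k) (suc k C 2) ⟩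
    suc k C 2 + suc k       ≡⟨ +-suc (suc k C 2) k ⟩
    suc (suc k C 2 + k)     ≤⟨ ≰⇒> t≰ ⟩
    t                       ∎
  j = t ∸ s
  j≤1+k : j ≤ suc k
  j≤1+k = ≤-trans (∸-monoˡ-≤ s t≤) (≤-reflexive (m+n∸m≡n s (suc k)))
  j′+j≡1+k : suc k ∸ j + j ≡ suc k
  j′+j≡1+k = m∸n+n≡m j≤1+k
  t≡ : t ≡ suc (suc k ∸ j + j) C 2 + j
  t≡ = trans (sym (m+[n∸m]≡n s≤t)) (cong (λ c → suc c C 2 + j) (sym j′+j≡1+k))

realisable-[1+m]C2+t : ∀ m k t → k ≤ m → t ≤ suc k C 2 + k →
  Realisable (suc m + k) (suc m C 2 + t)
realisable-[1+m]C2+t m k t k≤m t≤ with C2-decomposition k t t≤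
... | b , j , b+j≤k , t≡ =
  subst₂ Realisable edges≡ (sym lineEdges≡)
    (realisable-+ (k ∸ (b + j))
      (_ , linkedStars b j m , edges-linkedStars b j m j≤m , lineEdges-linkedStars b j m j≤m))
  where
  j≤m : j ≤ m
  j≤m = ≤-trans (m≤n+m j b) (≤-trans b+j≤k k≤m)
  regroup : ∀ x c m → x + (suc c + m) ≡ suc m + (x + c)
  regroup = solve-∀
  edges≡ : k ∸ (b + j) + (suc (b + j) + m) ≡ suc m + k
  edges≡ = trans (regroup (k ∸ (b + j)) (b + j) m) (cong (suc m +_) (m∸n+n≡m b+j≤k))
  lineEdges≡ : suc m C 2 + t ≡ suc (b + j) C 2 + (suc m C 2 + j)
  lineEdges≡ = trans (cong (suc m C 2 +_) t≡) (x∙yz≈y∙xz (suc m C 2) (suc (b + j) C 2) j)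

mainTheorem16 : (N Δ : ℕ) → N < 2 * Δ → Δ ≤ N →
    (M : ℕ) → Δ C 2 ≤ M → LeF M N Δ →
    Σ ℕ (λ n → Σ (Graph n) (λ G → (edges G ≡ N) × (lineEdges G ≡ M)))
mainTheorem16 N zero () _ _ _ _
mainTheorem16 N (suc m) _ _ M _ (zero , H , (_ , () , _) , _)
mainTheorem16 N (suc m) N<2Δ _ M ΔC2≤M (suc n , H , (eH≡N , ΔH≡Δ , _) , M≤LH) =
  subst₂ Realisable Δ+k≡N (m+[n∸m]≡n ΔC2≤M) (realisable-[1+m]C2+t m k (M ∸ suc m C 2) k≤m t≤)
  where
  v : Fin (suc n)
  v = proj₁ (maxF-attained (degree H))
  dv≡Δ : degree H v ≡ suc m
  dv≡Δ = trans (proj₂ (maxF-attained (degree H))) ΔH≡Δ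
  k : ℕ
  k = edges (removeVertex H v)
  Δ+k≡N : suc m + k ≡ N
  Δ+k≡N = trans (cong (_+ k) (sym dv≡Δ)) (trans (sym (edges-removeVertex H v)) eH≡N)
  k≤m : k ≤ m
  k≤m = s≤s⁻¹ (+-cancelˡ-< (suc m) k (suc m)
          (subst₂ _<_ (sym Δ+k≡N) (cong (suc m +_) (+-identityʳ (suc m))) N<2Δ))
  t≤ : M ∸ suc m C 2 ≤ suc k C 2 + k
  t≤ = begin
    M ∸ suc m C 2
      ≤⟨ ∸-monoˡ-≤ (suc m C 2) (≤-trans M≤LH (lineEdges≤degreeC2+[1+e]C2+e H v)) ⟩
    degree H v C 2 + (suc k C 2 + k) ∸ suc m C 2
      ≡⟨ cong (λ d → d C 2 + (suc k C 2 + k) ∸ suc m C 2) dv≡Δ ⟩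
    suc m C 2 + (suc k C 2 + k) ∸ suc m C 2
      ≡⟨ m+n∸m≡n (suc m C 2) (suc k C 2 + k) ⟩
    suc k C 2 + k ∎
    where open ≤-Reasoning
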